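{- Let $\mathcal{G}$ be a signed, colored graph of type $(n,n)$ satisfying axioms (ax1), (ax2), (ax3), (ax5) and having $\mathrm{LSP}_4$. Then $\mathcal{G}$ has $\mathrm{LSF}_4$ if and only if $W_i(\mathcal{G})$ is empty for all $1<i<n$.
   Context: For $\sigma=(\sigma_1,\dots,\sigma_{m-1})\in\{\pm1\}^{m-1}$, $Q_\sigma(X)=\sum x_{i_1}\cdots x_{i_m}$ over $i_1\le\cdots\le i_m$ with $i_j<i_{j+1}$ whenever $\sigma_j=-1$; $s_\lambda$ is the Schur function. A signed, colored graph of type $(n,N)$ is $(V,\sigma,E_2\cup\cdots\cup E_{n-1})$ with $V$ finite, $\sigma:V\to\{\pm1\}^{N-1}$ ($\sigma(v)_j$ the $j$-th entry) and for $1<i<n$ a set $E_i$ of $2$-element subsets of $V$; $E_j$ is empty for other $j$. If $w$ lies in a unique $i$-edge $\{w,x\}$, write $x=E_i(w)$ and say $w$ has an $i$-neighbour; compositions $E_iE_j(w)=E_i(E_j(w))$. Axioms: (ax1) $\sigma(w)_{i-1}=-\sigma(w)_i$ iff $w$ lies in some $i$-edge, and then in a unique one. (ax2) if $\{w,x\}\in E_i$ then $\sigma(w)_j=-\sigma(x)_j$ for $j=i-1,i$ and $\sigma(w)_h=\sigma(x)_h$ for $h<i-2$, $h>i+1$. (ax3) if $\{w,x\}\in E_i$ and $\sigma(w)_{i-2}=-\sigma(x)_{i-2}$ then $\sigma(w)_{i-2}=-\sigma(w)_{i-1}$; if $\sigma(w)_{i+1}=-\sigma(x)_{i+1}$ then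 $\sigma(w)_{i+1}=-\sigma(w)_i$. (ax5) if $\{w,x\}\in E_i$, $\{x,y\}\in E_j$, $|i-j|\ge3$, there is $v$ with $\{w,v\}\in E_j$, $\{v,y\}\in E_i$. For a connected component $\mathcal{C}$ of $(V,E_{i-1}\cup E_i)$, $2<i<n$, its restricted degree-$4$ generating function is $\sum_{v\in\mathcal{C}}Q_{(\sigma(v)_{i-2},\sigma(v)_{i-1},\sigma(v)_i)}$. $\mathrm{LSP}_4$: all of these are symmetric and Schur positive. $\mathrm{LSF}_4$: each equals a single Schur function. A vertex $w$ has $i$-type W if $w$ has an $(i-1)$-neighbour and $\sigma(w)_i=-\sigma(E_{i-1}(w))_i$. A non-flat $i$-chain is a sequence $(w_1,\dots,w_{2h})$ of distinct vertices with $w_{2j-1}=E_i(w_{2j})$ for $1\le j\le h$ and $w_{2j+1}=E_{i-1}(w_{2j})$ for $1\le j<h$. $W_i(\mathcal{G})$ is the set of vertices $w$ such that $w=w_j$ for some non-flat $i$-chain $(w_1,\dots,w_{2h})$ and some $1<j<2h$. -}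

module Defs where

open import Data.Nat using (ℕ; zero; suc; _+_; _∸_; _≤_; _<_; _≤ᵇ_; _<ᵇ_)
open import Data.Bool using (Bool; true; false; _∧_; if_then_else_)
open import Data.Nat.ListAction using (sum)
open import Data.List using (List; []; _∷_; length; map; concatMap; concat; upTo; allFin; zip; foldr)
open import Data.List.Relation.Unary.All using (All)
open import Data.List.Relation.Unary.Unique.Propositional using (Unique)
open import Data.List.Membership.Propositional using (_∈_)
open import Data.Vec as V using (Vec)
open import Data.Fin using (Fin)
open import Data.Product using (Σ; _×_; _,_; ∃)
open import Data.Sum using (_⊎_)
open import Data.Empty using (⊥)
open import Relation.Nullary using (¬_)
open import Relation.Binary.PropositionalEquality using (_≡_)

data Sign : Set where
  pos neg : Sign

-_ˢ : Sign → Sign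
- pos ˢ = neg
- neg ˢ = pos

-- 1-based lookup σ(v)_j in a sign vector; out-of-range indices return a
-- junk value (pos) but are never used by the axioms/definitions below.
_!_ : ∀ {m} → Vec Sign m → ℕ → Sign
_!_ v zero = pos
_!_ V.[] (suc j) = pos
_!_ (x V.∷ xs) (suc zero) = x
_!_ (x V.∷ xs) (suc (suc j)) = xs ! suc j

-- Formal power series of bounded degree are represented by their
-- coefficient functions on monomials.  A monomial x_{u1}...x_{um} is
-- encoded by the unique weakly increasing word u = (u1 ≤ ... ≤ um)
-- (any length m, including 0).

incr : List ℕ → Bool
incr [] = true
incr (x ∷ []) = true
incr (x ∷ y ∷ ys) = (x ≤ᵇ y) ∧ incr (y ∷ ys)

Monomial : List ℕ → Set
Monomial u = incr u ≡ true

-- admissibility of a sequence i_1 ≤ ... ≤ i_m for Q_σ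
-- (strict i_j < i_{j+1} whenever σ_j = -1)
adm : List Sign → List ℕ → Bool
adm [] (x ∷ []) = true
adm (pos ∷ ss) (x ∷ y ∷ ys) = (x ≤ᵇ y) ∧ adm ss (y ∷ ys)
adm (neg ∷ ss) (x ∷ y ∷ ys) = (x <ᵇ y) ∧ adm ss (y ∷ ys)
adm _ _ = false

-- coefficient of the monomial u in Q_σ: the only summand of Q_σ producing
-- the monomial u is the sequence u itself.
Qcoeff : List Sign → List ℕ → ℕ
Qcoeff s u = if adm s u then 1 else 0

decr : List ℕ → Bool
decr [] = true
decr (x ∷ []) = true
decr (x ∷ y ∷ ys) = (y ≤ᵇ x) ∧ decr (y ∷ ys)

allPos : List ℕ → Bool
allPos [] = true
allPos (x ∷ xs) = (1 ≤ᵇ x) ∧ allPos xs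

IsPartition : List ℕ → Set
IsPartition λ' = (decr λ' ∧ allPos λ') ≡ true

words : ℕ → ℕ → List (List ℕ)
words B zero = [] ∷ []
words B (suc l) = concatMap (λ x → map (x ∷_) (words B l)) (upTo (suc B))

-- all fillings of the Young diagram of shape λ (rows top to bottom,
-- English convention) with entries in {0..B}
fillings : ℕ → List ℕ → List (List (List ℕ))
fillings B [] = [] ∷ []
fillings B (l ∷ ls) = concatMap (λ row → map (row ∷_) (fillings B ls)) (words B l)

colStrict : List ℕ → List ℕ → Bool
colStrict r r' = foldr (λ p b → (Data.Product.proj₁ p <ᵇ Data.Product.proj₂ p) ∧ b) true (zip r r')

isSSYT : List (List ℕ) → Bool
isSSYT [] = true
isSSYT (r ∷ []) = incr r
isSSYT (r ∷ r' ∷ rs) = incr r ∧ colStrict r r' ∧ isSSYT (r' ∷ rs)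

insertℕ : ℕ → List ℕ → List ℕ
insertℕ x [] = x ∷ []
insertℕ x (y ∷ ys) = if x ≤ᵇ y then x ∷ y ∷ ys else y ∷ insertℕ x ys

sortℕ : List ℕ → List ℕ
sortℕ [] = []
sortℕ (x ∷ xs) = insertℕ x (sortℕ xs)

eqℕ : ℕ → ℕ → Bool
eqℕ zero zero = true
eqℕ (suc a) (suc b) = eqℕ a b
eqℕ _ _ = false

eqList : List ℕ → List ℕ → Bool
eqList [] [] = true
eqList (x ∷ xs) (y ∷ ys) = eqℕ x y ∧ eqList xs ys
eqList _ _ = false

maxList : List ℕ → ℕ
maxList = foldr Data.Nat._⊔_ 0

count : {A : Set} → (A → Bool) → List A → ℕ
count p [] = 0
count p (x ∷ xs) = (if p x then 1 else 0) + count p xs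

-- coefficient of the monomial u in s_λ = number of SSYT of shape λ whose
-- multiset of entries is that of u (entries of such a tableau are ≤ max u)
schurCoeff : List ℕ → List ℕ → ℕ
schurCoeff λ' u =
  count (λ T → isSSYT T ∧ eqList (sortℕ (concat T)) u) (fillings (maxList u) λ')

record SCGraph (n N : ℕ) : Set₁ where
  field
    k     : ℕ
    σ     : Fin k → Vec Sign (N ∸ 1)
    -- E i w x = true  iff  {w , x} ∈ E_i
    E     : ℕ → Fin k → Fin k → Bool
    E-sym   : ∀ i w x → E i w x ≡ true → E i x w ≡ true
    E-irrefl : ∀ i w → E i w w ≡ false
    E-range : ∀ i w x → E i w x ≡ true → (1 < i) × (i < n)

module _ {n N : ℕ} (G : SCGraph n N) where
  open SCGraph G

  Edge : ℕ → Fin k → Fin k → Set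
  Edge i w x = E i w x ≡ true

  -- x = E_i(w): {w,x} is the unique i-edge containing w
  IsNbr : ℕ → Fin k → Fin k → Set
  IsNbr i w x = Edge i w x × (∀ y → Edge i w y → y ≡ x)

  Ax1 : Set
  Ax1 = ∀ i → 1 < i → i < n → ∀ w →
        ((σ w ! (i ∸ 1)) ≡ - (σ w ! i) ˢ → ∃ λ x → Edge i w x)
      × ((∃ λ x → Edge i w x) → (σ w ! (i ∸ 1)) ≡ - (σ w ! i) ˢ)
      × (∀ x y → Edge i w x → Edge i w y → x ≡ y)

  Ax2 : Set
  Ax2 = ∀ i w x → Edge i w x →
        ((σ w ! (i ∸ 1)) ≡ - (σ x ! (i ∸ 1)) ˢ)
      × ((σ w ! i) ≡ - (σ x ! i) ˢ)
      × (∀ h → 1 ≤ h → h ≤ N ∸ 1 → (h + 2 < i ⊎ i + 1 < h) → σ w ! h ≡ σ x ! h)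

  Ax3 : Set
  Ax3 = ∀ i w x → Edge i w x →
        (2 < i → (σ w ! (i ∸ 2)) ≡ - (σ x ! (i ∸ 2)) ˢ
               → (σ w ! (i ∸ 2)) ≡ - (σ w ! (i ∸ 1)) ˢ)
      × (i + 1 ≤ N ∸ 1 → (σ w ! (i + 1)) ≡ - (σ x ! (i + 1)) ˢ
               → (σ w ! (i + 1)) ≡ - (σ w ! i) ˢ)

  Ax5 : Set
  Ax5 = ∀ i j w x y → Edge i w x → Edge j x y → (i + 3 ≤ j ⊎ j + 3 ≤ i) →
        ∃ λ v → Edge j w v × Edge i v y

  data Path (i : ℕ) : Fin k → Fin k → Set where
    here : ∀ {v} → Path i v v
    step : ∀ {v x y} → (Edge (i ∸ 1) v x ⊎ Edge i v x) → Path i x y → Path i v y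

  IsComponent : ℕ → (Fin k → Bool) → Set
  IsComponent i C =
      (∃ λ v → C v ≡ true)
    × (∀ v x → C v ≡ true → (Edge (i ∸ 1) v x ⊎ Edge i v x) → C x ≡ true)
    × (∀ v x → C v ≡ true → C x ≡ true → Path i v x)

  -- coefficient of the monomial u in the restricted degree-4 generating
  -- function  Σ_{v ∈ C} Q_{(σ(v)_{i-2}, σ(v)_{i-1}, σ(v)_i)}
  genFun4 : ℕ → (Fin k → Bool) → List ℕ → ℕ
  genFun4 i C u = sum (map (λ v → if C v
       then Qcoeff ((σ v ! (i ∸ 2)) ∷ (σ v ! (i ∸ 1)) ∷ (σ v ! i) ∷ []) u
       else 0) (allFin k))

  -- LSP_4: every such generating function is symmetric and Schur positive,
  -- i.e. a nonnegative (necessarily integral) combination Σ_λ c_λ s_λ,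
  -- encoded as a finite list of partitions with multiplicities
  LSP4 : Set
  LSP4 = ∀ i → 2 < i → i < n → ∀ C → IsComponent i C →
         Σ (List (List ℕ)) λ ls → All IsPartition ls ×
           (∀ u → Monomial u → genFun4 i C u ≡ sum (map (λ μ → schurCoeff μ u) ls))

  LSF4 : Set
  LSF4 = ∀ i → 2 < i → i < n → ∀ C → IsComponent i C →
         Σ (List ℕ) λ μ → IsPartition μ ×
           (∀ u → Monomial u → genFun4 i C u ≡ schurCoeff μ u)

  -- non-flat i-chains, as lists of pairs (w_{2j-1} , w_{2j}), j = 1..h, h ≥ 1
  ChainPairs : ℕ → List (Fin k × Fin k) → Set
  ChainPairs i [] = ⊥
  ChainPairs i ((a , b) ∷ []) = IsNbr i b a
  ChainPairs i ((a , b) ∷ (a' , b') ∷ ps) =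
    IsNbr i b a × IsNbr (i ∸ 1) b a' × ChainPairs i ((a' , b') ∷ ps)

  flatten : List (Fin k × Fin k) → List (Fin k)
  flatten [] = []
  flatten ((a , b) ∷ ps) = a ∷ b ∷ flatten ps

  dropLast : {A : Set} → List A → List A
  dropLast [] = []
  dropLast (x ∷ []) = []
  dropLast (x ∷ y ∷ ys) = x ∷ dropLast (y ∷ ys)

  -- w_2 , ... , w_{2h-1}
  interior : {A : Set} → List A → List A
  interior [] = []
  interior (x ∷ xs) = dropLast xs

  InW : ℕ → Fin k → Set
  InW i w = Σ (List (Fin k × Fin k)) λ ps →
              ChainPairs i ps × Unique (flatten ps) × w ∈ interior (flatten ps)

module Submission where

-- Every series below is homogeneous of degree 4 and is probed only through
-- its coefficients on the five test monomials x₀⁴, x₀³x₁, x₀²x₁², x₀²x₁x₂,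
-- x₀x₁x₂x₃ (its profile).  On these the Kostka matrix of the partitions
-- of 4 is unitriangular, so a Schur positive series with the profile of
-- s_λ is s_λ, and no Schur positive series has profile (0,0,1,2,4); the
-- superstandard tableau shows that only partitions of 4 occur.
--
-- (⇒) The first four vertices of a non-flat i-chain are distinct and lie
-- in one component of (V, E_{i-1} ∪ E_i), built as a reachability fixed
-- point; its generating function then has coefficient ≥ 4 on x₀x₁x₂x₃,
-- while every Schur function of degree 4 has coefficient ≤ 3 there.
-- (⇐) By (ax1)-(ax3) a component is an isolated vertex of type (s,s,s) or
-- contains a vertex of type (s,-s,s); walking from it, the absence of
-- W_i-vertices leaves the patterns pair, hook and square, with the
-- profiles of s₂₂, of s₃₁ or s₂₁₁, and the impossible (0,0,1,2,4).
-- Generating functions of components are summed over explicit closed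
-- duplicate-free lists of their vertices.

open import Defs
open import Data.Nat using (ℕ; _<_)
open import Function.Bundles using (_⇔_; mk⇔)
open import Relation.Nullary using (¬_)

open import Algebra.Properties.CommutativeSemigroup using (x∙yz≈y∙xz)
open import Data.Bool using (Bool; true; false; _∧_; _∨_; if_then_else_)
open import Data.Bool.ListAction using (any; or)
open import Data.Bool.Properties using (T-≡) renaming (_≟_ to _≟ᵇ_)
open import Data.Empty using (⊥; ⊥-elim)
open import Data.Fin using (Fin; _≟_)
open import Data.Fin.Properties using (any?)
open import Data.List using (List; []; _∷_; length; map; concat; replicate; _++_; allFin)
open import Data.List.Properties using (length-++; length-replicate; length-tabulate; map-∘; map-cong)
open import Data.List.Relation.Binary.Pointwise using (Pointwise; []; _∷_)
open import Data.List.Relation.Unary.All as All using (All; []; _∷_)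
open import Data.List.Relation.Unary.All.Properties as All using (++⁺; concat⁻; replicate⁺)
open import Data.List.Relation.Unary.Any as Any using (here; there)
open import Data.List.Relation.Unary.Any.Properties using (any⁺; any⁻)
open import Data.List.Relation.Unary.AllPairs using ([]; _∷_)
open import Data.List.Relation.Unary.Unique.Propositional using (Unique)
open import Data.List.Relation.Unary.Unique.Propositional.Properties using (allFin⁺)
open import Data.List.Membership.Propositional using (_∈_; _∉_)
open import Data.List.Membership.Propositional.Properties using (∈-map⁺; ∈-concatMap⁺; ∈-upTo⁺; ∈-allFin)
open import Data.Nat using (zero; suc; _+_; _*_; _∸_; _≤_; _≤ᵇ_; _<ᵇ_; z≤n; s≤s)
open import Data.Nat.ListAction using (sum)
open import Data.Nat.Properties hiding (_≟_)
open import Data.Nat.Tactic.RingSolver using (solve-∀)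
open import Data.Product using (Σ; _×_; _,_; ∃; proj₁; proj₂)
open import Data.Sum using (_⊎_; inj₁; inj₂)
open import Function.Base using (_∘_)
open import Function.Bundles using (Equivalence)
open import Relation.Nullary using (yes; no; does)
open import Relation.Nullary.Decidable using (_×-dec_)
open import Relation.Binary.PropositionalEquality

∧-elim : ∀ {x y} → x ∧ y ≡ true → (x ≡ true) × (y ≡ true)
∧-elim {true} {true} _ = refl , refl

∧-intro : ∀ {x y} → x ≡ true → y ≡ true → x ∧ y ≡ true
∧-intro refl refl = refl

∨-elim : ∀ {x y} → x ∨ y ≡ true → (x ≡ true) ⊎ (y ≡ true)
∨-elim {true}  _ = inj₁ refl
∨-elim {false} h = inj₂ h

∨-introʳ : ∀ x {y} → y ≡ true → x ∨ y ≡ true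
∨-introʳ true  _ = refl
∨-introʳ false h = h

bool-ext : ∀ {x y} → (y ≡ true → x ≡ true) → (x ≡ true → y ≡ true) → x ≡ y
bool-ext {false} {false} _ _   = refl
bool-ext {false} {true}  y⇒x _ = y⇒x refl
bool-ext {true}  {false} _ x⇒y = sym (x⇒y refl)
bool-ext {true}  {true}  _ _   = refl

not-false : ∀ {x} → ¬ (x ≡ false) → x ≡ true
not-false {false} x≢false = ⊥-elim (x≢false refl)
not-false {true}  _       = refl

≤ᵇ-true : ∀ {m n} → m ≤ n → (m ≤ᵇ n) ≡ true
≤ᵇ-true m≤n = Equivalence.to T-≡ (≤⇒≤ᵇ m≤n)

<ᵇ-true : ∀ {m n} → m < n → (m <ᵇ n) ≡ true
<ᵇ-true m<n = Equivalence.to T-≡ (<⇒<ᵇ m<n)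

any-true : ∀ {A : Set} (p : A → Bool) {x xs} → x ∈ xs → p x ≡ true → any p xs ≡ true
any-true p x∈xs px = Equivalence.to T-≡ (any⁺ p (Any.map (λ { refl → Equivalence.from T-≡ px }) x∈xs))

any-witness : ∀ {A : Set} (p : A → Bool) xs → any p xs ≡ true → ∃ λ x → p x ≡ true
any-witness p xs h with Any.satisfied (any⁻ p xs (Equivalence.from T-≡ h))
... | x , px = x , Equivalence.to T-≡ px

sum-member : ∀ {A : Set} (f : A → ℕ) {x xs} → x ∈ xs → f x ≤ sum (map f xs)
sum-member f (here refl) = m≤m+n _ _
sum-member f {xs = y ∷ _} (there x∈xs) = ≤-trans (sum-member f x∈xs) (m≤n+m _ (f y))

sum-positive : ∀ {A : Set} (f : A → ℕ) xs → 1 ≤ sum (map f xs) → Σ A λ x → 1 ≤ f x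
sum-positive f (x ∷ xs) positive with f x in fx
... | suc _ = x , subst (1 ≤_) (sym fx) (s≤s z≤n)
... | zero  = sum-positive f xs positive

indicator : Bool → ℕ
indicator c = if c then 1 else 0

count-member : ∀ {A : Set} (p : A → Bool) {x xs} → x ∈ xs → p x ≡ true → 1 ≤ count p xs
count-member p (here refl) px rewrite px = s≤s z≤n
count-member p {xs = y ∷ ys} (there x∈ys) px = ≤-trans (count-member p x∈ys px) (m≤n+m (count p ys) (indicator (p y)))

indicator-mono : ∀ {c d} → (c ≡ true → d ≡ true) → indicator c ≤ indicator d
indicator-mono {false} _ = z≤n
indicator-mono {true}  c⇒d rewrite c⇒d refl = ≤-refl

count-mono : ∀ {A : Set} (p q : A → Bool) xs → (∀ x → p x ≡ true → q x ≡ true) → count p xs ≤ count q xs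
count-mono p q []       p⇒q = z≤n
count-mono p q (x ∷ xs) p⇒q = +-mono-≤ (indicator-mono (p⇒q x)) (count-mono p q xs p⇒q)

count-strict : ∀ {A : Set} (p q : A → Bool) {x xs} → (∀ x → p x ≡ true → q x ≡ true) →
  x ∈ xs → p x ≡ false → q x ≡ true → count p xs < count q xs
count-strict p q {xs = _ ∷ xs} p⇒q (here refl) px qx rewrite px | qx = s≤s (count-mono p q xs p⇒q)
count-strict p q {xs = y ∷ _} p⇒q (there x∈xs) px qx =
  +-mono-≤-< (indicator-mono (p⇒q y)) (count-strict p q p⇒q x∈xs px qx)

count-≤-length : ∀ {A : Set} (p : A → Bool) xs → count p xs ≤ length xs
count-≤-length p []       = z≤n
count-≤-length p (x ∷ xs) = +-mono-≤ (indicator-mono {d = true} (λ _ → refl)) (count-≤-length p xs)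

incr-cons : ∀ x ys → incr ys ≡ true → All (x ≤_) ys → incr (x ∷ ys) ≡ true
incr-cons x []       _       _         = refl
incr-cons x (y ∷ ys) incr-ys (x≤y ∷ _) = ∧-intro (≤ᵇ-true x≤y) incr-ys

sort-incr : ∀ xs → incr xs ≡ true → sortℕ xs ≡ xs
sort-incr []           _ = refl
sort-incr (x ∷ [])     _ = refl
sort-incr (x ∷ y ∷ ys) h
  rewrite sort-incr (y ∷ ys) (proj₂ (∧-elim {x ≤ᵇ y} h)) | proj₁ (∧-elim {x ≤ᵇ y} h) = refl

eqℕ-refl : ∀ n → eqℕ n n ≡ true
eqℕ-refl zero    = refl
eqℕ-refl (suc n) = eqℕ-refl n

eqList-refl : ∀ xs → eqList xs xs ≡ true
eqList-refl []       = refl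
eqList-refl (x ∷ xs) rewrite eqℕ-refl x = eqList-refl xs

words-complete : ∀ B w → All (_≤ B) w → w ∈ words B (length w)
words-complete B []      _           = here refl
words-complete B (x ∷ w) (x≤B ∷ w≤B) =
  ∈-concatMap⁺ (λ y → map (y ∷_) (words B (length w)))
    (Any.map (λ { refl → ∈-map⁺ (x ∷_) (words-complete B w w≤B) }) (∈-upTo⁺ (s≤s x≤B)))

fillings-complete : ∀ B T → All (All (_≤ B)) T → T ∈ fillings B (map length T)
fillings-complete B []      _           = here refl
fillings-complete B (r ∷ T) (r≤B ∷ T≤B) =
  ∈-concatMap⁺ (λ row → map (row ∷_) (fillings B (map length T)))
    (Any.map (λ { refl → ∈-map⁺ (r ∷_) (fillings-complete B T T≤B) }) (words-complete B r r≤B))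

maxList-bounds : ∀ xs → All (_≤ maxList xs) xs
maxList-bounds []       = []
maxList-bounds (x ∷ xs) = m≤m⊔n x _ ∷ All.map (λ p → ≤-trans p (m≤n⊔m x _)) (maxList-bounds xs)

-- Filling row r of the diagram μ with the
-- value r gives a semistandard tableau, so s_μ has a nonzero coefficient
-- on its (increasing) content word, whose degree is |μ|.

superstandard : List ℕ → ℕ → List (List ℕ)
superstandard []      r = []
superstandard (m ∷ μ) r = replicate m r ∷ superstandard μ (suc r)

superstandardWord : List ℕ → List ℕ
superstandardWord μ = concat (superstandard μ 0)

superstandard-shape : ∀ μ r → map length (superstandard μ r) ≡ μ
superstandard-shape []      r = refl
superstandard-shape (m ∷ μ) r = cong₂ _∷_ (length-replicate m) (superstandard-shape μ (suc r))

incr-replicate : ∀ m r → incr (replicate m r) ≡ true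
incr-replicate zero    r = refl
incr-replicate (suc m) r = incr-cons r _ (incr-replicate m r) (replicate⁺ m ≤-refl)

superstandard-ssyt : ∀ μ r → isSSYT (superstandard μ r) ≡ true
superstandard-ssyt []           r = refl
superstandard-ssyt (m ∷ [])     r = incr-replicate m r
superstandard-ssyt (m ∷ m' ∷ μ) r =
  ∧-intro (incr-replicate m r) (∧-intro (columns m m') (superstandard-ssyt (m' ∷ μ) (suc r)))
  where
  columns : ∀ m m' → colStrict (replicate m r) (replicate m' (suc r)) ≡ true
  columns zero    m'       = refl
  columns (suc m) zero     = refl
  columns (suc m) (suc m') rewrite <ᵇ-true (n<1+n r) = columns m m'

superstandard-content : ∀ μ r →
  incr (concat (superstandard μ r)) ≡ true × All (r ≤_) (concat (superstandard μ r))
superstandard-content []      r = refl , []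
superstandard-content (m ∷ μ) r = prepend m , above m
  where
  rest = concat (superstandard μ (suc r))
  above : ∀ m → All (r ≤_) (replicate m r ++ rest)
  above m = ++⁺ (replicate⁺ m ≤-refl) (All.map (≤-trans (n≤1+n r)) (proj₂ (superstandard-content μ (suc r))))
  prepend : ∀ m → incr (replicate m r ++ rest) ≡ true
  prepend zero    = proj₁ (superstandard-content μ (suc r))
  prepend (suc m) = incr-cons r _ (prepend m) (above m)

superstandard-length : ∀ μ r → length (concat (superstandard μ r)) ≡ sum μ
superstandard-length []      r = refl
superstandard-length (m ∷ μ) r =
  trans (length-++ (replicate m r)) (cong₂ _+_ (length-replicate m) (superstandard-length μ (suc r)))

superstandardWord-monomial : ∀ μ → Monomial (superstandardWord μ)
superstandardWord-monomial μ = proj₁ (superstandard-content μ 0)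

schur-superstandard : ∀ μ → 1 ≤ schurCoeff μ (superstandardWord μ)
schur-superstandard μ = count-member _ member isTableau
  where
  T = superstandard μ 0
  u = superstandardWord μ
  member : T ∈ fillings (maxList u) μ
  member = subst (λ shape → T ∈ fillings (maxList u) shape) (superstandard-shape μ 0)
                 (fillings-complete (maxList u) T (concat⁻ (maxList-bounds u)))
  isTableau : (isSSYT T ∧ eqList (sortℕ u) u) ≡ true
  isTableau rewrite superstandard-ssyt μ 0 | sort-incr u (superstandardWord-monomial μ) = eqList-refl u

data Shape : Set where
  s4 s31 s22 s211 s1111 : Shape

partition : Shape → List ℕ
partition s4    = 4 ∷ []
partition s31   = 3 ∷ 1 ∷ []
partition s22   = 2 ∷ 2 ∷ []
partition s211  = 2 ∷ 1 ∷ 1 ∷ []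
partition s1111 = 1 ∷ 1 ∷ 1 ∷ 1 ∷ []

partitionsOf4 : ∀ μ → allPos μ ≡ true → decr μ ≡ true → sum μ ≡ 4 → Σ Shape λ s → μ ≡ partition s
partitionsOf4 (4 ∷ [])             _ _ _ = s4 , refl
partitionsOf4 (3 ∷ 1 ∷ [])         _ _ _ = s31 , refl
partitionsOf4 (2 ∷ 2 ∷ [])         _ _ _ = s22 , refl
partitionsOf4 (2 ∷ 1 ∷ 1 ∷ [])     _ _ _ = s211 , refl
partitionsOf4 (1 ∷ 1 ∷ 1 ∷ 1 ∷ []) _ _ _ = s1111 , refl
partitionsOf4 [] _ _ ()
partitionsOf4 (0 ∷ _) () _ _
partitionsOf4 (suc (suc (suc (suc (suc _)))) ∷ _) _ _ ()
partitionsOf4 (4 ∷ suc _ ∷ _) _ _ ()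
partitionsOf4 (4 ∷ 0 ∷ _) () _ _
partitionsOf4 (3 ∷ []) _ _ ()
partitionsOf4 (3 ∷ 0 ∷ _) () _ _
partitionsOf4 (3 ∷ suc (suc _) ∷ _) _ _ ()
partitionsOf4 (3 ∷ 1 ∷ suc _ ∷ _) _ _ ()
partitionsOf4 (3 ∷ 1 ∷ 0 ∷ _) () _ _
partitionsOf4 (2 ∷ []) _ _ ()
partitionsOf4 (2 ∷ 0 ∷ _) () _ _
partitionsOf4 (2 ∷ suc (suc (suc _)) ∷ _) _ _ ()
partitionsOf4 (2 ∷ 2 ∷ suc _ ∷ _) _ _ ()
partitionsOf4 (2 ∷ 2 ∷ 0 ∷ _) () _ _
partitionsOf4 (2 ∷ 1 ∷ []) _ _ ()
partitionsOf4 (2 ∷ 1 ∷ 0 ∷ _) () _ _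
partitionsOf4 (2 ∷ 1 ∷ suc (suc _) ∷ _) _ _ ()
partitionsOf4 (2 ∷ 1 ∷ 1 ∷ suc _ ∷ _) _ _ ()
partitionsOf4 (2 ∷ 1 ∷ 1 ∷ 0 ∷ _) () _ _
partitionsOf4 (1 ∷ []) _ _ ()
partitionsOf4 (1 ∷ 0 ∷ _) () _ _
partitionsOf4 (1 ∷ suc (suc _) ∷ _) _ () _
partitionsOf4 (1 ∷ 1 ∷ []) _ _ ()
partitionsOf4 (1 ∷ 1 ∷ 0 ∷ _) () _ _
partitionsOf4 (1 ∷ 1 ∷ suc (suc _) ∷ _) _ () _
partitionsOf4 (1 ∷ 1 ∷ 1 ∷ []) _ _ ()
partitionsOf4 (1 ∷ 1 ∷ 1 ∷ 0 ∷ _) () _ _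
partitionsOf4 (1 ∷ 1 ∷ 1 ∷ suc (suc _) ∷ _) _ _ ()
partitionsOf4 (1 ∷ 1 ∷ 1 ∷ 1 ∷ suc _ ∷ _) _ _ ()
partitionsOf4 (1 ∷ 1 ∷ 1 ∷ 1 ∷ 0 ∷ _) () _ _

u4 u31 u22 u211 u1111 : List ℕ
u4    = 0 ∷ 0 ∷ 0 ∷ 0 ∷ []
u31   = 0 ∷ 0 ∷ 0 ∷ 1 ∷ []
u22   = 0 ∷ 0 ∷ 1 ∷ 1 ∷ []
u211  = 0 ∷ 0 ∷ 1 ∷ 2 ∷ []
u1111 = 0 ∷ 1 ∷ 2 ∷ 3 ∷ []

Profile : Set
Profile = ℕ × ℕ × ℕ × ℕ × ℕ

profile : (List ℕ → ℕ) → Profile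
profile f = f u4 , f u31 , f u22 , f u211 , f u1111

kostka : Shape → Profile
kostka s = profile (schurCoeff (partition s))

_⊕_ : Profile → Profile → Profile
(a , b , c , d , e) ⊕ (a' , b' , c' , d' , e') = a + a' , b + b' , c + c' , d + d' , e + e'

size : Profile → ℕ
size (a , b , c , d , e) = a + b + c + d + e

unit : Shape → Profile
unit s4    = 1 , 0 , 0 , 0 , 0
unit s31   = 0 , 1 , 0 , 0 , 0
unit s22   = 0 , 0 , 1 , 0 , 0
unit s211  = 0 , 0 , 0 , 1 , 0
unit s1111 = 0 , 0 , 0 , 0 , 1

multiplicities : List Shape → Profile
multiplicities []       = 0 , 0 , 0 , 0 , 0
multiplicities (s ∷ xs) = unit s ⊕ multiplicities xs

-- The Kostka matrix on the test monomials is unitriangular: the profile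
-- of a sum of Schur functions is this linear map applied to the
-- multiplicities of the shapes.
triangular : Profile → Profile
triangular (a , b , c , d , e) =
  a , a + b , a + b + c , a + 2 * b + c + d , a + 3 * b + 2 * c + 3 * d + e

kostka-triangular : ∀ s → kostka s ≡ triangular (unit s)
kostka-triangular s4    = refl
kostka-triangular s31   = refl
kostka-triangular s22   = refl
kostka-triangular s211  = refl
kostka-triangular s1111 = refl

triangular-⊕ : ∀ m m' → triangular (m ⊕ m') ≡ triangular m ⊕ triangular m'
triangular-⊕ (a , b , c , d , e) (a' , b' , c' , d' , e') =
  cong (a + a' ,_) (cong₂ _,_ (second a b a' b') (cong₂ _,_ (third a b c a' b' c')
    (cong₂ _,_ (fourth a b c d a' b' c' d') (fifth a b c d e a' b' c' d' e'))))
  where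
  second : ∀ a b a' b' → a + a' + (b + b') ≡ a + b + (a' + b')
  second = solve-∀
  third : ∀ a b c a' b' c' → a + a' + (b + b') + (c + c') ≡ a + b + c + (a' + b' + c')
  third = solve-∀
  fourth : ∀ a b c d a' b' c' d' →
    a + a' + 2 * (b + b') + (c + c') + (d + d') ≡ a + 2 * b + c + d + (a' + 2 * b' + c' + d')
  fourth = solve-∀
  fifth : ∀ a b c d e a' b' c' d' e' →
    a + a' + 3 * (b + b') + 2 * (c + c') + 3 * (d + d') + (e + e')
      ≡ a + 3 * b + 2 * c + 3 * d + e + (a' + 3 * b' + 2 * c' + 3 * d' + e')
  fifth = solve-∀

size-⊕ : ∀ m m' → size (m ⊕ m') ≡ size m + size m'
size-⊕ (a , b , c , d , e) (a' , b' , c' , d' , e') = linear a b c d e a' b' c' d' e'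
  where
  linear : ∀ a b c d e a' b' c' d' e' → a + a' + (b + b') + (c + c') + (d + d') + (e + e')
                                      ≡ a + b + c + d + e + (a' + b' + c' + d' + e')
  linear = solve-∀

schurSum : List Shape → List ℕ → ℕ
schurSum xs u = sum (map (λ s → schurCoeff (partition s) u) xs)

profile-schurSum : ∀ xs → profile (schurSum xs) ≡ triangular (multiplicities xs)
profile-schurSum []       = refl
profile-schurSum (s ∷ xs) = begin
  kostka s ⊕ profile (schurSum xs)                      ≡⟨ cong₂ _⊕_ (kostka-triangular s) (profile-schurSum xs) ⟩
  triangular (unit s) ⊕ triangular (multiplicities xs)  ≡⟨ triangular-⊕ (unit s) (multiplicities xs) ⟨
  triangular (multiplicities (s ∷ xs))                  ∎
  where open ≡-Reasoning

length-multiplicities : ∀ xs → length xs ≡ size (multiplicities xs)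
length-multiplicities []       = refl
length-multiplicities (s ∷ xs) =
  trans (cong suc (length-multiplicities xs)) (sym (trans (size-⊕ (unit s) _) (cong (_+ size (multiplicities xs)) (size-unit s))))
  where
  size-unit : ∀ s → size (unit s) ≡ 1
  size-unit s4    = refl
  size-unit s31   = refl
  size-unit s22   = refl
  size-unit s211  = refl
  size-unit s1111 = refl

-- Solving the triangular system: the profile of a single Schur function
-- forces exactly one shape ...
triangular-kostka : ∀ s m → triangular m ≡ kostka s → size m ≡ 1
triangular-kostka s4    (a , b , c , d , e) refl = refl
triangular-kostka s31   (a , b , c , d , e) refl = refl
triangular-kostka s22   (a , b , c , d , e) refl = refl
triangular-kostka s211  (a , b , c , d , e) refl = refl
triangular-kostka s1111 (a , b , c , d , e) refl = refl

triangular-unsolvable : ∀ m → triangular m ≡ (0 , 0 , 1 , 2 , 4) → ⊥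
triangular-unsolvable (a , b , c , d , e) ()

SchurPositive : (List ℕ → ℕ) → Set
SchurPositive f = Σ (List (List ℕ)) λ ls → All IsPartition ls ×
  (∀ u → Monomial u → f u ≡ sum (map (λ μ → schurCoeff μ u) ls))

SingleSchur : (List ℕ → ℕ) → Set
SingleSchur f = Σ (List ℕ) λ μ → IsPartition μ × (∀ u → Monomial u → f u ≡ schurCoeff μ u)

Homogeneous4 : (List ℕ → ℕ) → Set
Homogeneous4 f = ∀ u → 1 ≤ f u → length u ≡ 4

profile-cong : ∀ {f g} → (∀ u → Monomial u → f u ≡ g u) → profile f ≡ profile g
profile-cong f≗g =
  cong₂ _,_ (f≗g u4 refl) (cong₂ _,_ (f≗g u31 refl) (cong₂ _,_ (f≗g u22 refl)
    (cong₂ _,_ (f≗g u211 refl) (f≗g u1111 refl))))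

partition-isPartition : ∀ s → IsPartition (partition s)
partition-isPartition s4    = refl
partition-isPartition s31   = refl
partition-isPartition s22   = refl
partition-isPartition s211  = refl
partition-isPartition s1111 = refl

allShapes : ∀ ls → All (λ μ → Σ Shape λ s → μ ≡ partition s) ls → Σ (List Shape) λ xs → ls ≡ map partition xs
allShapes []       []               = [] , refl
allShapes (μ ∷ ls) ((s , refl) ∷ p) = s ∷ proj₁ (allShapes ls p) , cong (μ ∷_) (proj₂ (allShapes ls p))

module Degree4 {f : List ℕ → ℕ} (homogeneous : Homogeneous4 f) where

  occurringShape : ∀ μ → IsPartition μ → 1 ≤ f (superstandardWord μ) → Σ Shape λ s → μ ≡ partition s
  occurringShape μ isP occurs =
    partitionsOf4 μ (proj₂ (∧-elim isP)) (proj₁ (∧-elim isP))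
      (trans (sym (superstandard-length μ 0)) (homogeneous _ occurs))

  shapes : SchurPositive f → Σ (List Shape) λ xs → ∀ u → Monomial u → f u ≡ schurSum xs u
  shapes (ls , isP , expansion) = reindex (allShapes ls (All.tabulate shapeOf))
    where
    shapeOf : ∀ {μ} → μ ∈ ls → Σ Shape λ s → μ ≡ partition s
    shapeOf {μ} μ∈ls = occurringShape μ (All.lookup isP μ∈ls)
      (≤-trans (schur-superstandard μ)
        (≤-trans (sum-member (λ ν → schurCoeff ν _) μ∈ls)
          (≤-reflexive (sym (expansion _ (superstandardWord-monomial μ))))))
    reindex : (Σ (List Shape) λ xs → ls ≡ map partition xs) →
              Σ (List Shape) λ xs → ∀ u → Monomial u → f u ≡ schurSum xs u
    reindex (xs , refl) = xs , λ u mono → trans (expansion u mono) (cong sum (sym (map-∘ xs)))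

  profile-expansion : ∀ xs → (∀ u → Monomial u → f u ≡ schurSum xs u) →
    profile f ≡ triangular (multiplicities xs)
  profile-expansion xs expansion = trans (profile-cong expansion) (profile-schurSum xs)

  single : ∀ s → profile f ≡ kostka s → SchurPositive f → SingleSchur f
  single s prof positive with shapes positive
  ... | xs , expansion = oneShape xs (trans (length-multiplicities xs) (triangular-kostka s _ solves)) expansion
    where
    solves : triangular (multiplicities xs) ≡ kostka s
    solves = trans (sym (profile-expansion xs expansion)) prof
    oneShape : ∀ xs → length xs ≡ 1 → (∀ u → Monomial u → f u ≡ schurSum xs u) → SingleSchur f
    oneShape (y ∷ []) _ expansion =
      partition y , partition-isPartition y , λ u mono → trans (expansion u mono) (+-identityʳ _)

  notPositive : profile f ≡ (0 , 0 , 1 , 2 , 4) → SchurPositive f → ⊥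
  notPositive prof positive with shapes positive
  ... | xs , expansion = triangular-unsolvable (multiplicities xs) (trans (sym (profile-expansion xs expansion)) prof)

  single-bound : SingleSchur f → f u1111 ≤ 3
  single-bound (μ , isP , expansion) with occurringShape μ isP
    (≤-trans (schur-superstandard μ) (≤-reflexive (sym (expansion _ (superstandardWord-monomial μ)))))
  ... | s , refl = ≤-trans (≤-reflexive (expansion u1111 refl)) (standardTableaux s)
    where
    standardTableaux : ∀ s → schurCoeff (partition s) u1111 ≤ 3
    standardTableaux s4    = s≤s z≤n
    standardTableaux s31   = ≤-refl
    standardTableaux s22   = s≤s (s≤s z≤n)
    standardTableaux s211  = ≤-refl
    standardTableaux s1111 = s≤s z≤n

-- The restricted generating function is homogeneous of degree 4: the
-- only monomials of Q_σ are those indexed by admissible words of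
-- length |σ| + 1.

adm-length : ∀ t u → adm t u ≡ true → length u ≡ suc (length t)
adm-length []        (x ∷ [])     _ = refl
adm-length (pos ∷ t) (x ∷ y ∷ ys) h = cong suc (adm-length t (y ∷ ys) (proj₂ (∧-elim {x ≤ᵇ y} h)))
adm-length (neg ∷ t) (x ∷ y ∷ ys) h = cong suc (adm-length t (y ∷ ys) (proj₂ (∧-elim {x <ᵇ y} h)))

Qcoeff-degree : ∀ t u → 1 ≤ Qcoeff t u → length u ≡ suc (length t)
Qcoeff-degree t u positive with adm t u in admissible
... | true = adm-length t u admissible

genFun4-homogeneous : ∀ {n N} (G : SCGraph n N) i C → Homogeneous4 (genFun4 G i C)
genFun4-homogeneous G i C u positive with sum-positive _ (allFin (SCGraph.k G)) positive
... | v , positiveAt-v with C v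
... | true = Qcoeff-degree ((σ v ! (i ∸ 2)) ∷ (σ v ! (i ∸ 1)) ∷ (σ v ! i) ∷ []) u positiveAt-v
  where open SCGraph G

-- With the set C equal to
-- (resp. containing) a duplicate-free list S, the sum equals (resp. is
-- at least) the sum over S; both follow by removing the points of S
-- from C one at a time.

module RestrictedSum {k : ℕ} (f : Fin k → ℕ) where

  restrict : (Fin k → Bool) → Fin k → ℕ
  restrict C w = if C w then f w else 0

  ΣC : (Fin k → Bool) → ℕ
  ΣC C = sum (map (restrict C) (allFin k))

  without : (Fin k → Bool) → Fin k → Fin k → Bool
  without C s w = if does (w ≟ s) then false else C w

  restrict-without : ∀ C {s w} → w ≢ s → restrict (without C s) w ≡ restrict C w
  restrict-without C {s} {w} w≢s with w ≟ s
  ... | yes w≡s = ⊥-elim (w≢s w≡s)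
  ... | no  _   = refl

  without-true : ∀ C {s w} → w ≢ s → C w ≡ true → without C s w ≡ true
  without-true C {s} {w} w≢s Cw with w ≟ s
  ... | yes w≡s = ⊥-elim (w≢s w≡s)
  ... | no  _   = Cw

  without-other : ∀ C {s w} → without C s w ≡ true → w ≢ s × C w ≡ true
  without-other C {s} {w} h with w ≟ s
  ... | no w≢s = w≢s , h

  sum-without-absent : ∀ C s L → s ∉ L → sum (map (restrict (without C s)) L) ≡ sum (map (restrict C) L)
  sum-without-absent C s []      _   = refl
  sum-without-absent C s (w ∷ L) s∉ =
    cong₂ _+_ (restrict-without C (λ { refl → s∉ (here refl) })) (sum-without-absent C s L (s∉ ∘ there))

  sum-without : ∀ C s L → C s ≡ true → Unique L → s ∈ L →
    sum (map (restrict C) L) ≡ f s + sum (map (restrict (without C s)) L)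
  sum-without C s (s ∷ L) Cs (s∉L ∷ _) (here refl) with s ≟ s
  ... | no s≢s  = ⊥-elim (s≢s refl)
  ... | yes _ rewrite Cs =
    cong (f s +_) (sym (sum-without-absent C s L (λ s∈L → All.lookup s∉L s∈L refl)))
  sum-without C s (w ∷ L) Cs (w∉L ∷ uniqueL) (there s∈L) = begin
    restrict C w + sum (map (restrict C) L)
      ≡⟨ cong₂ _+_ (sym (restrict-without C (All.lookup w∉L s∈L))) (sum-without C s L Cs uniqueL s∈L) ⟩
    restrict (without C s) w + (f s + sum (map (restrict (without C s)) L))
      ≡⟨ x∙yz≈y∙xz +-commutativeSemigroup (restrict (without C s) w) (f s) _ ⟩
    f s + sum (map (restrict (without C s)) (w ∷ L)) ∎
    where open ≡-Reasoning

  without-all : ∀ C {s S} → All (s ≢_) S → All (λ w → C w ≡ true) S → All (λ w → without C s w ≡ true) S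
  without-all C []            []          = []
  without-all C (s≢w ∷ s∉S) (Cw ∷ inC) = without-true C (λ w≡s → s≢w (sym w≡s)) Cw ∷ without-all C s∉S inC

  ΣC-without : ∀ C s → C s ≡ true → ΣC C ≡ f s + ΣC (without C s)
  ΣC-without C s Cs = sum-without C s (allFin k) Cs (allFin⁺ k) (∈-allFin s)

  ΣC-empty : ∀ C → (∀ w → C w ≡ false) → ΣC C ≡ 0
  ΣC-empty C empty = go (allFin k)
    where
    go : ∀ L → sum (map (restrict C) L) ≡ 0
    go []      = refl
    go (w ∷ L) rewrite empty w = go L

  ΣC-exact : ∀ C S → Unique S → All (λ w → C w ≡ true) S → (∀ w → C w ≡ true → w ∈ S) →
    ΣC C ≡ sum (map f S)
  ΣC-exact C [] _ _ covered = ΣC-empty C outside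
    where
    outside : ∀ w → C w ≡ false
    outside w with C w in Cw
    ... | true  = ⊥-elim (nowhere (covered w Cw))
      where
      nowhere : w ∉ []
      nowhere ()
    ... | false = refl
  ΣC-exact C (s ∷ S) (s∉S ∷ uniqueS) (Cs ∷ inC) covered =
    trans (ΣC-without C s Cs) (cong (f s +_) (ΣC-exact (without C s) S uniqueS (without-all C s∉S inC) covered′))
    where
    covered′ : ∀ w → without C s w ≡ true → w ∈ S
    covered′ w h with without-other C h
    ... | w≢s , Cw with covered w Cw
    ...   | here w≡s = ⊥-elim (w≢s w≡s)
    ...   | there w∈S = w∈S

  ΣC-lower : ∀ C S → Unique S → All (λ w → C w ≡ true) S → sum (map f S) ≤ ΣC C
  ΣC-lower C []      _                  _           = z≤n
  ΣC-lower C (s ∷ S) (s∉S ∷ uniqueS) (Cs ∷ inC) =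
    ≤-trans (+-monoʳ-≤ (f s) (ΣC-lower (without C s) S uniqueS (without-all C s∉S inC)))
            (≤-reflexive (sym (ΣC-without C s Cs)))

-- It is computed as the set of vertices reachable from b in at most t
-- steps for t = |V|: the reachable sets grow strictly until they
-- stabilise, so they are stable after |V| steps.

module ComponentOf {n N} (G : SCGraph n N) (i : ℕ) (b : Fin (SCGraph.k G)) where
  open SCGraph G

  Adjacent : Fin k → Fin k → Set
  Adjacent v w = Edge G (i ∸ 1) v w ⊎ Edge G i v w

  adjacent : Fin k → Fin k → Bool
  adjacent v w = E (i ∸ 1) v w ∨ E i v w

  adjacent-true : ∀ {v w} → Adjacent v w → adjacent v w ≡ true
  adjacent-true (inj₁ e) rewrite e = refl
  adjacent-true {v} {w} (inj₂ e) = ∨-introʳ (E (i ∸ 1) v w) e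

  adjacent-sym : ∀ {v w} → Adjacent v w → Adjacent w v
  adjacent-sym (inj₁ e) = inj₁ (E-sym _ _ _ e)
  adjacent-sym (inj₂ e) = inj₂ (E-sym _ _ _ e)

  _++ᴾ_ : ∀ {u v w} → Path G i u v → Path G i v w → Path G i u w
  here        ++ᴾ q = q
  step e p ++ᴾ q = step e (p ++ᴾ q)

  reach : ℕ → Fin k → Bool
  reach zero    w = does (b ≟ w)
  reach (suc t) w = reach t w ∨ any (λ y → reach t y ∧ adjacent y w) (allFin k)

  reach-start : ∀ t → reach t b ≡ true
  reach-start zero with b ≟ b
  ... | yes _   = refl
  ... | no b≢b = ⊥-elim (b≢b refl)
  reach-start (suc t) rewrite reach-start t = refl

  reach-mono : ∀ t w → reach t w ≡ true → reach (suc t) w ≡ true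
  reach-mono t w h rewrite h = refl

  reach-paths : ∀ t w → reach t w ≡ true → Path G i b w × Path G i w b
  reach-paths zero w h with b ≟ w
  ... | yes refl = here , here
  reach-paths (suc t) w h with ∨-elim {reach t w} h
  ... | inj₁ earlier = reach-paths t w earlier
  ... | inj₂ later with any-witness _ (allFin k) later
  ...   | y , yw with ∧-elim {reach t y} yw
  ...     | reach-y , adj with reach-paths t y reach-y
  ...       | to-y , from-y =
    to-y ++ᴾ step (edge adj) here , step (adjacent-sym (edge adj)) from-y
    where
    edge : adjacent y w ≡ true → Adjacent y w
    edge = ∨-elim

  Stable : ℕ → Set
  Stable t = ∀ w → reach (suc t) w ≡ reach t w

  stable-suc : ∀ t → Stable t → Stable (suc t)
  stable-suc t stable w =
    cong₂ _∨_ (stable w) (cong or (map-cong (λ y → cong (_∧ adjacent y w) (stable y)) (allFin k)))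

  reached : ℕ → ℕ
  reached t = count (reach t) (allFin k)

  reached-≤ : ∀ t → reached t ≤ k
  reached-≤ t = ≤-trans (count-≤-length (reach t) (allFin k)) (≤-reflexive (length-tabulate (λ x → x)))

  stable-or-grows : ∀ t → Stable t ⊎ reached t < reached (suc t)
  stable-or-grows t with any? (λ w → (reach (suc t) w ≟ᵇ true) ×-dec (reach t w ≟ᵇ false))
  ... | yes (w , new , old) = inj₂ (count-strict (reach t) (reach (suc t)) (reach-mono t) (∈-allFin w) old new)
  ... | no nothing-new = inj₁ stable
    where
    stable : Stable t
    stable w = bool-ext (reach-mono t w) (λ now → not-false (λ old → nothing-new (w , now , old)))

  stable-or-large : ∀ t → Stable t ⊎ suc (suc t) ≤ reached (suc t)
  stable-or-large zero with stable-or-grows zero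
  ... | inj₁ stable = inj₁ stable
  ... | inj₂ grows  = inj₂ (≤-trans (s≤s (count-member (reach 0) (∈-allFin b) (reach-start 0))) grows)
  stable-or-large (suc t) with stable-or-large t
  ... | inj₁ stable = inj₁ (stable-suc t stable)
  ... | inj₂ large with stable-or-grows (suc t)
  ...   | inj₁ stable = inj₁ stable
  ...   | inj₂ grows  = inj₂ (≤-trans (s≤s large) grows)

  -- Since at most |V| vertices can be reached, stability holds after |V| steps.
  stable-at-size : Stable k
  stable-at-size with stable-or-large k
  ... | inj₁ stable = stable
  ... | inj₂ large  = ⊥-elim (<⇒≱ (≤-trans (n≤1+n _) large) (reached-≤ (suc k)))

  component : Fin k → Bool
  component = reach k

  component-closed : ∀ v w → component v ≡ true → Adjacent v w → component w ≡ true
  component-closed v w cv adj =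
    trans (sym (stable-at-size w))
      (∨-introʳ (reach k w) (any-true (λ y → reach k y ∧ adjacent y w) (∈-allFin v) (∧-intro cv (adjacent-true adj))))

  component-start : component b ≡ true
  component-start = reach-start k

  isComponent : IsComponent G i component
  isComponent = (b , component-start) , component-closed ,
    λ v w cv cw → proj₂ (reach-paths k v cv) ++ᴾ proj₁ (reach-paths k w cw)

neg-involutive : ∀ s → - (- s ˢ) ˢ ≡ s
neg-involutive pos = refl
neg-involutive neg = refl

neg-distinct : ∀ s → s ≢ - s ˢ
neg-distinct pos ()
neg-distinct neg ()

sign-cases : ∀ x y → (x ≡ y) ⊎ (x ≡ - y ˢ)
sign-cases pos pos = inj₁ refl
sign-cases pos neg = inj₂ refl
sign-cases neg pos = inj₂ refl
sign-cases neg neg = inj₁ refl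

neg-swap : ∀ {x y} → x ≡ - y ˢ → y ≡ - x ˢ
neg-swap {x} {y} x≡-y = trans (sym (neg-involutive y)) (cong -_ˢ (sym x≡-y))

module Colour {n N} (G : SCGraph n N) {d : ℕ} where
  open SCGraph G

  module _ (ax1 : Ax1 G) (1<d : 1 < d) (d<n : d < n) where

    nbr-exists : ∀ w → σ w ! (d ∸ 1) ≡ - (σ w ! d) ˢ → ∃ (Edge G d w)
    nbr-exists w = proj₁ (ax1 d 1<d d<n w)

    nbr-none : ∀ {w x} → σ w ! (d ∸ 1) ≡ σ w ! d → ¬ Edge G d w x
    nbr-none {w} {x} same e = neg-distinct _ (trans (sym same) (proj₁ (proj₂ (ax1 d 1<d d<n w)) (x , e)))

    nbr-unique : ∀ {w x y} → Edge G d w x → Edge G d w y → x ≡ y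
    nbr-unique {w} = proj₂ (proj₂ (ax1 d 1<d d<n w)) _ _

    isNbr : ∀ {w x} → Edge G d w x → IsNbr G d w x
    isNbr e = e , λ y e′ → nbr-unique e′ e

  module _ (ax2 : Ax2 G) where

    flips-below : ∀ {w x} → Edge G d w x → σ x ! (d ∸ 1) ≡ - (σ w ! (d ∸ 1)) ˢ
    flips-below {w} {x} e = neg-swap (proj₁ (ax2 d w x e))

    flips-at : ∀ {w x} → Edge G d w x → σ x ! d ≡ - (σ w ! d) ˢ
    flips-at {w} {x} e = neg-swap (proj₁ (proj₂ (ax2 d w x e)))

  module _ (ax3 : Ax3 G) where

    keeps-below : ∀ {w x} → Edge G d w x → 2 < d →
      σ w ! (d ∸ 2) ≡ σ w ! (d ∸ 1) → σ x ! (d ∸ 2) ≡ σ w ! (d ∸ 2)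
    keeps-below {w} {x} e 2<d same with sign-cases (σ x ! (d ∸ 2)) (σ w ! (d ∸ 2))
    ... | inj₁ kept    = kept
    ... | inj₂ flipped =
      ⊥-elim (neg-distinct _ (trans (sym same) (proj₁ (ax3 d w x e) 2<d (neg-swap flipped))))

    keeps-above : ∀ {w x} → Edge G d w x → suc d ≤ N ∸ 1 →
      σ w ! suc d ≡ σ w ! d → σ x ! suc d ≡ σ w ! suc d
    keeps-above {w} {x} e bound same with sign-cases (σ x ! suc d) (σ w ! suc d)
    ... | inj₁ kept    = kept
    ... | inj₂ flipped = ⊥-elim (neg-distinct _ (trans (sym same) (ax3-above (neg-swap flipped))))
      where
      ax3-above : σ w ! suc d ≡ - (σ x ! suc d) ˢ → σ w ! suc d ≡ - (σ w ! d) ˢ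
      ax3-above = subst (λ p → σ w ! p ≡ - (σ x ! p) ˢ → σ w ! p ≡ - (σ w ! d) ˢ) (+-comm d 1)
                        (proj₂ (ax3 d w x e) (subst (_≤ N ∸ 1) (+-comm 1 d) bound))

-- A vertex of W_i sits inside a non-flat i-chain, whose
-- first four vertices a, b, a', b' are distinct with a = E_i(b),
-- a' = E_{i-1}(b) and a' = E_i(b'); conversely four such vertices put b
-- into W_i.

module Chains {n N} (G : SCGraph n N) (i : ℕ) where
  open SCGraph G

  record Square : Set where
    field
      a b a′ b′ : Fin k
      a-b   : IsNbr G i b a
      b-a′  : IsNbr G (i ∸ 1) b a′
      a′-b′ : IsNbr G i b′ a′
      distinct : Unique (a ∷ b ∷ a′ ∷ b′ ∷ [])

  square-in-W : (sq : Square) → InW G i (Square.b sq)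
  square-in-W sq = (a , b) ∷ (a′ , b′) ∷ [] , (a-b , b-a′ , a′-b′) , distinct , here refl
    where open Square sq

  W-square : ∀ {w} → InW G i w → Square
  W-square ((a , b) ∷ (a′ , b′) ∷ ps , (a-b , b-a′ , chain) ,
            ((a≢b ∷ a≢a′ ∷ a≢b′ ∷ _) ∷ (b≢a′ ∷ b≢b′ ∷ _) ∷ (a′≢b′ ∷ _) ∷ _) , _) =
    record { a-b = a-b ; b-a′ = b-a′ ; a′-b′ = head chain
           ; distinct = (a≢b ∷ a≢a′ ∷ a≢b′ ∷ []) ∷ (b≢a′ ∷ b≢b′ ∷ []) ∷ (a′≢b′ ∷ []) ∷ [] ∷ [] }
    where
    head : ∀ {ps} → ChainPairs G i ((a′ , b′) ∷ ps) → IsNbr G i b′ a′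
    head {[]}    nbr       = nbr
    head {_ ∷ _} (nbr , _) = nbr
  W-square ([]    , () , _)
  W-square ((_ , _) ∷ [] , _ , _ , ())

Q-squarefree : ∀ x y z → Qcoeff (x ∷ y ∷ z ∷ []) u1111 ≡ 1
Q-squarefree pos pos pos = refl
Q-squarefree pos pos neg = refl
Q-squarefree pos neg pos = refl
Q-squarefree pos neg neg = refl
Q-squarefree neg pos pos = refl
Q-squarefree neg pos neg = refl
Q-squarefree neg neg pos = refl
Q-squarefree neg neg neg = refl

sum-ones : ∀ {A : Set} (f : A → ℕ) xs → (∀ x → f x ≡ 1) → sum (map f xs) ≡ length xs
sum-ones f []       _    = refl
sum-ones f (x ∷ xs) ones rewrite ones x = cong suc (sum-ones f xs ones)

module _ {n N} (G : SCGraph n N) (i : ℕ) (sq : Chains.Square G i) where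
  open SCGraph G
  open Chains.Square sq
  open ComponentOf G i b

  square-coefficient : 4 ≤ genFun4 G i component u1111
  square-coefficient =
    ≤-trans (≤-reflexive (sym four)) (RestrictedSum.ΣC-lower Qv component (a ∷ b ∷ a′ ∷ b′ ∷ []) distinct inC)
    where
    Qv : Fin k → ℕ
    Qv v = Qcoeff ((σ v ! (i ∸ 2)) ∷ (σ v ! (i ∸ 1)) ∷ (σ v ! i) ∷ []) u1111
    four : sum (map Qv (a ∷ b ∷ a′ ∷ b′ ∷ [])) ≡ 4
    four = sum-ones Qv (a ∷ b ∷ a′ ∷ b′ ∷ []) (λ v → Q-squarefree (σ v ! (i ∸ 2)) (σ v ! (i ∸ 1)) (σ v ! i))
    in-a′ = component-closed b a′ component-start (inj₁ (proj₁ b-a′))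
    inC : All (λ v → component v ≡ true) (a ∷ b ∷ a′ ∷ b′ ∷ [])
    inC = component-closed b a component-start (inj₂ (proj₁ a-b))
        ∷ component-start
        ∷ in-a′
        ∷ component-closed a′ b′ in-a′ (inj₂ (E-sym _ _ _ (proj₁ a′-b′)))
        ∷ []

LSF4⇒noW : ∀ {n N} (G : SCGraph n N) → LSF4 G → ∀ i → 1 < i → i < n → ∀ w → ¬ InW G i w
LSF4⇒noW G lsf (suc zero) (s≤s ()) _ _ _
LSF4⇒noW G lsf (suc (suc zero)) _ _ w inW =
  <-irrefl refl (proj₁ (SCGraph.E-range G 1 _ _ (proj₁ (Chains.Square.b-a′ (Chains.W-square G 2 inW)))))
LSF4⇒noW G lsf i@(suc (suc (suc _))) _ i<n w inW =
  <-irrefl refl (≤-trans (square-coefficient G i sq)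
    (Degree4.single-bound (genFun4-homogeneous G i component) (lsf i (s≤s (s≤s (s≤s z≤n))) i<n component isComponent)))
  where
  sq = Chains.W-square G i inW
  open ComponentOf G i (Chains.Square.b sq)

QΣ : List (List Sign) → List ℕ → ℕ
QΣ ts u = sum (map (λ t → Qcoeff t u) ts)

isolatedTypes pairTypes hookTypes squareTypes : Sign → List (List Sign)
isolatedTypes s = (s ∷ s ∷ s ∷ []) ∷ []
pairTypes     s = (s ∷ - s ˢ ∷ s ∷ []) ∷ (- s ˢ ∷ s ∷ - s ˢ ∷ []) ∷ []
hookTypes     s = (- s ˢ ∷ s ∷ s ∷ []) ∷ (s ∷ - s ˢ ∷ s ∷ []) ∷ (s ∷ s ∷ - s ˢ ∷ []) ∷ []
squareTypes   s = (- s ˢ ∷ s ∷ s ∷ []) ∷ (s ∷ - s ˢ ∷ s ∷ []) ∷ (- s ˢ ∷ s ∷ - s ˢ ∷ []) ∷ (s ∷ - s ˢ ∷ - s ˢ ∷ []) ∷ []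

isolatedShape hookShape : Sign → Shape
isolatedShape pos = s4
isolatedShape neg = s1111
hookShape pos = s31
hookShape neg = s211

isolated-profile : ∀ s → profile (QΣ (isolatedTypes s)) ≡ kostka (isolatedShape s)
isolated-profile pos = refl
isolated-profile neg = refl

pair-profile : ∀ s → profile (QΣ (pairTypes s)) ≡ kostka s22
pair-profile pos = refl
pair-profile neg = refl

hook-profile : ∀ s → profile (QΣ (hookTypes s)) ≡ kostka (hookShape s)
hook-profile pos = refl
hook-profile neg = refl

square-profile : ∀ s → profile (QΣ (squareTypes s)) ≡ (0 , 0 , 1 , 2 , 4)
square-profile pos = refl
square-profile neg = refl

pattern #0 = here refl
pattern #1 = there #0
pattern #2 = there #1
pattern #3 = there #2

module Window {n} (G : SCGraph n n) (ax1 : Ax1 G) (ax2 : Ax2 G) (ax3 : Ax3 G)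
              (j : ℕ) (i<n : suc (suc (suc j)) < n) where
  open SCGraph G

  i : ℕ
  i = suc (suc (suc j))

  σ₁ σ₂ σ₃ : Fin k → Sign
  σ₁ w = σ w ! suc j
  σ₂ w = σ w ! suc (suc j)
  σ₃ w = σ w ! i

  type : Fin k → List Sign
  type w = σ₁ w ∷ σ₂ w ∷ σ₃ w ∷ []

  type≡ : ∀ {w a b c} → σ₁ w ≡ a → σ₂ w ≡ b → σ₃ w ≡ c → type w ≡ a ∷ b ∷ c ∷ []
  type≡ w₁ w₂ w₃ = cong₂ _∷_ w₁ (cong₂ _∷_ w₂ (cong (_∷ []) w₃))

  Lower Upper : Fin k → Fin k → Set
  Lower = Edge G (suc (suc j))
  Upper = Edge G i

  private
    module Lo = Colour G {suc (suc j)}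
    module Up = Colour G {i}
    1<lower : 1 < suc (suc j)
    1<lower = s≤s (s≤s z≤n)
    1<upper : 1 < i
    1<upper = s≤s (s≤s z≤n)

  lower-exists : ∀ w → σ₁ w ≡ - σ₂ w ˢ → ∃ (Lower w)
  lower-exists = Lo.nbr-exists ax1 1<lower (<⇒≤ i<n)

  upper-exists : ∀ w → σ₂ w ≡ - σ₃ w ˢ → ∃ (Upper w)
  upper-exists = Up.nbr-exists ax1 1<upper i<n

  no-lower : ∀ {w x} → σ₁ w ≡ σ₂ w → ¬ Lower w x
  no-lower = Lo.nbr-none ax1 1<lower (<⇒≤ i<n)

  no-upper : ∀ {w x} → σ₂ w ≡ σ₃ w → ¬ Upper w x
  no-upper = Up.nbr-none ax1 1<upper i<n

  lower-unique : ∀ {w x y} → Lower w x → Lower w y → x ≡ y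
  lower-unique = Lo.nbr-unique ax1 1<lower (<⇒≤ i<n)

  upper-unique : ∀ {w x y} → Upper w x → Upper w y → x ≡ y
  upper-unique = Up.nbr-unique ax1 1<upper i<n

  lower-nbr : ∀ {w x} → Lower w x → IsNbr G (suc (suc j)) w x
  lower-nbr = Lo.isNbr ax1 1<lower (<⇒≤ i<n)

  upper-nbr : ∀ {w x} → Upper w x → IsNbr G i w x
  upper-nbr = Up.isNbr ax1 1<upper i<n

  lower-flips₁ : ∀ {w x} → Lower w x → σ₁ x ≡ - σ₁ w ˢ
  lower-flips₁ = Lo.flips-below ax2

  lower-flips₂ : ∀ {w x} → Lower w x → σ₂ x ≡ - σ₂ w ˢ
  lower-flips₂ = Lo.flips-at ax2

  upper-flips₂ : ∀ {w x} → Upper w x → σ₂ x ≡ - σ₂ w ˢ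
  upper-flips₂ = Up.flips-below ax2

  upper-flips₃ : ∀ {w x} → Upper w x → σ₃ x ≡ - σ₃ w ˢ
  upper-flips₃ = Up.flips-at ax2

  lower-keeps₃ : ∀ {w x} → Lower w x → σ₃ w ≡ σ₂ w → σ₃ x ≡ σ₃ w
  lower-keeps₃ e = Lo.keeps-above ax3 e (≤∸1 i<n)
    where
    ≤∸1 : ∀ {a m} → suc a ≤ m → a ≤ m ∸ 1
    ≤∸1 (s≤s a≤m) = a≤m

  upper-keeps₁ : ∀ {w x} → Upper w x → σ₁ w ≡ σ₂ w → σ₁ x ≡ σ₁ w
  upper-keeps₁ e = Up.keeps-below ax3 e (s≤s (s≤s (s≤s z≤n)))

  lower-sym : ∀ {w x} → Lower w x → Lower x w
  lower-sym = E-sym _ _ _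

  upper-sym : ∀ {w x} → Upper w x → Upper x w
  upper-sym = E-sym _ _ _

  differ : ∀ (f : Fin k → Sign) {w x t} → f w ≡ t → f x ≡ - t ˢ → w ≢ x
  differ f w≡t x≡-t refl = neg-distinct _ (trans (sym w≡t) x≡-t)

  differ′ : ∀ (f : Fin k → Sign) {w x t} → f w ≡ - t ˢ → f x ≡ t → w ≢ x
  differ′ f w≡-t x≡t w≡x = differ f x≡t w≡-t (sym w≡x)

  -- A component C of (V, E_{i-1} ∪ E_i) is determined by any closed,
  -- duplicate-free list of its vertices, and so is its generating function.

  module OnComponent (C : Fin k → Bool) (comp : IsComponent G i C) where

    Gf : List ℕ → ℕ
    Gf = genFun4 G i C

    NbrsIn : List (Fin k) → Fin k → Set
    NbrsIn S w = ∀ x → Lower w x ⊎ Upper w x → x ∈ S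

    record Exhausts (S : List (Fin k)) (ts : List (List Sign)) : Set where
      field
        distinct : Unique S
        inside   : All (λ w → C w ≡ true) S
        closed   : All (NbrsIn S) S
        types    : Pointwise (λ w t → type w ≡ t) S ts

    stays-in : ∀ {S v w} → All (NbrsIn S) S → v ∈ S → Path G i v w → w ∈ S
    stays-in closed v∈S here       = v∈S
    stays-in closed v∈S (step e p) = stays-in closed (All.lookup closed v∈S _ e) p

    types-sum : ∀ {S ts} u → Pointwise (λ w t → type w ≡ t) S ts →
      sum (map (λ w → Qcoeff (type w) u) S) ≡ QΣ ts u
    types-sum u []          = refl
    types-sum u (_∷_ {x = w} refl ps) = cong (Qcoeff (type w) u +_) (types-sum u ps)

    exhausts-Gf : ∀ {v S ts} → Exhausts (v ∷ S) ts → ∀ u → Gf u ≡ QΣ ts u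
    exhausts-Gf {v} {S} ex u =
      trans (RestrictedSum.ΣC-exact (λ w → Qcoeff (type w) u) C (v ∷ S) distinct inside covered) (types-sum u types)
      where
      open Exhausts ex
      covered : ∀ w → C w ≡ true → w ∈ v ∷ S
      covered w Cw = stays-in closed (here refl) (proj₂ (proj₂ comp) v w (All.head inside) Cw)

    closure : ∀ {v w} → C v ≡ true → Lower v w ⊎ Upper v w → C w ≡ true
    closure {v} {w} = proj₁ (proj₂ comp) v w

    lower-only : ∀ {S w x} → Lower w x → x ∈ S → ∀ y → Lower w y → y ∈ S
    lower-only {S} e x∈S y e′ = subst (_∈ S) (lower-unique e e′) x∈S

    upper-only : ∀ {S w x} → Upper w x → x ∈ S → ∀ y → Upper w y → y ∈ S
    upper-only {S} e x∈S y e′ = subst (_∈ S) (upper-unique e e′) x∈S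

    lower-none : ∀ {S w} → σ₁ w ≡ σ₂ w → ∀ y → Lower w y → y ∈ S
    lower-none same y e = ⊥-elim (no-lower same e)

    upper-none : ∀ {S w} → σ₂ w ≡ σ₃ w → ∀ y → Upper w y → y ∈ S
    upper-none same y e = ⊥-elim (no-upper same e)

    nbrs : ∀ {S w} → (∀ y → Lower w y → y ∈ S) → (∀ y → Upper w y → y ∈ S) → NbrsIn S w
    nbrs lower upper y (inj₁ e) = lower y e
    nbrs lower upper y (inj₂ e) = upper y e

    isolated : ∀ {v} → C v ≡ true → σ₁ v ≡ σ₃ v → σ₂ v ≡ σ₃ v → Exhausts (v ∷ []) (isolatedTypes (σ₃ v))
    isolated Cv v₁ v₂ = record
      { distinct = [] ∷ []
      ; inside   = Cv ∷ []
      ; closed   = nbrs (lower-none (trans v₁ (sym v₂))) (upper-none v₂) ∷ []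
      ; types    = type≡ v₁ v₂ refl ∷ []
      }

    module _ (positive : SchurPositive Gf) where
      open Degree4 (genFun4-homogeneous G i C)

      exhausts-single : ∀ {v S ts} sh → Exhausts (v ∷ S) ts → profile (QΣ ts) ≡ kostka sh → SingleSchur Gf
      exhausts-single sh ex prof =
        single sh (trans (profile-cong (λ u _ → exhausts-Gf ex u)) prof) positive

      exhausts-notPositive : ∀ {v S ts} → Exhausts (v ∷ S) ts → profile (QΣ ts) ≡ (0 , 0 , 1 , 2 , 4) → ⊥
      exhausts-notPositive ex prof =
        notPositive (trans (profile-cong (λ u _ → exhausts-Gf ex u)) prof) positive

      -- Around a vertex m of type (s, -s, s), which has a lower
      -- neighbour x and an upper neighbour y.  Without W_i-vertices the
      -- component is the pair {m, x}, the hook {x, m, y} or the square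
      -- {x, m, y, z}; the last one is excluded by Schur positivity.

      module Middle (noW : ∀ w → ¬ InW G i w) (s : Sign) (m : Fin k)
                    (m₁ : σ₁ m ≡ s) (m₂ : σ₂ m ≡ - s ˢ) (m₃ : σ₃ m ≡ s) (Cm : C m ≡ true) where

        lower-of-m : ∃ (Lower m)
        lower-of-m = lower-exists m (trans m₁ (trans (sym (neg-involutive s)) (cong -_ˢ (sym m₂))))

        upper-of-m : ∃ (Upper m)
        upper-of-m = upper-exists m (trans m₂ (cong -_ˢ (sym m₃)))

        x y : Fin k
        x = proj₁ lower-of-m
        y = proj₁ upper-of-m

        m-x : Lower m x
        m-x = proj₂ lower-of-m

        m-y : Upper m y
        m-y = proj₂ upper-of-m

        x₁ : σ₁ x ≡ - s ˢ
        x₁ = trans (lower-flips₁ m-x) (cong -_ˢ m₁)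

        x₂ : σ₂ x ≡ s
        x₂ = trans (lower-flips₂ m-x) (trans (cong -_ˢ m₂) (neg-involutive s))

        y₂ : σ₂ y ≡ s
        y₂ = trans (upper-flips₂ m-y) (trans (cong -_ˢ m₂) (neg-involutive s))

        y₃ : σ₃ y ≡ - s ˢ
        y₃ = trans (upper-flips₃ m-y) (cong -_ˢ m₃)

        Cx : C x ≡ true
        Cx = closure Cm (inj₁ m-x)

        Cy : C y ≡ true
        Cy = closure Cm (inj₂ m-y)

        pair : σ₃ x ≡ - s ˢ → Upper x m → Exhausts (m ∷ x ∷ []) (pairTypes s)
        pair x₃ x-m = record
          { distinct = (differ′ σ₂ m₂ x₂ ∷ []) ∷ [] ∷ []
          ; inside   = Cm ∷ Cx ∷ []
          ; closed   = nbrs (lower-only m-x #1) (upper-only (upper-sym x-m) #1)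
                     ∷ nbrs (lower-only (lower-sym m-x) #0) (upper-only x-m #0)
                     ∷ []
          ; types    = type≡ m₁ m₂ m₃ ∷ type≡ x₁ x₂ x₃ ∷ []
          }

        -- x = (-s, s, -s) whose upper neighbour z is not m: (y, m, x, z)
        -- is a non-flat chain through m.
        W-at-m : ∀ {z} → σ₃ x ≡ - s ˢ → Upper x z → z ≢ m → ⊥
        W-at-m {z} x₃ x-z z≢m = noW m (Chains.square-in-W G i record
          { a-b = upper-nbr m-y ; b-a′ = lower-nbr m-x ; a′-b′ = upper-nbr (upper-sym x-z)
          ; distinct = (differ σ₂ y₂ m₂ ∷ y≢x ∷ differ σ₂ y₂ z₂ ∷ [])
                     ∷ (differ′ σ₂ m₂ x₂ ∷ (λ m≡z → z≢m (sym m≡z)) ∷ [])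
                     ∷ (differ σ₂ x₂ z₂ ∷ [])
                     ∷ [] ∷ []
          })
          where
          z₂ : σ₂ z ≡ - s ˢ
          z₂ = trans (upper-flips₂ x-z) (cong -_ˢ x₂)
          y≢x : y ≢ x
          y≢x y≡x = z≢m (upper-unique x-z (upper-sym (subst (Upper m) y≡x m-y)))

        hook : σ₃ x ≡ s → σ₁ y ≡ s → Exhausts (x ∷ m ∷ y ∷ []) (hookTypes s)
        hook x₃ y₁ = record
          { distinct = (differ σ₂ x₂ m₂ ∷ differ σ₃ x₃ y₃ ∷ []) ∷ (differ′ σ₂ m₂ y₂ ∷ []) ∷ [] ∷ []
          ; inside   = Cx ∷ Cm ∷ Cy ∷ []
          ; closed   = nbrs (lower-only (lower-sym m-x) #1) (upper-none (trans x₂ (sym x₃)))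
                     ∷ nbrs (lower-only m-x #0) (upper-only m-y #2)
                     ∷ nbrs (lower-none (trans y₁ (sym y₂))) (upper-only (upper-sym m-y) #1)
                     ∷ []
          ; types    = type≡ x₁ x₂ x₃ ∷ type≡ m₁ m₂ m₃ ∷ type≡ y₁ y₂ y₃ ∷ []
          }

        module _ (x₃ : σ₃ x ≡ s) (y₁ : σ₁ y ≡ - s ˢ) {z : Fin k} (y-z : Lower y z) where

          z₁ : σ₁ z ≡ s
          z₁ = trans (lower-flips₁ y-z) (trans (cong -_ˢ y₁) (neg-involutive s))

          z₂ : σ₂ z ≡ - s ˢ
          z₂ = trans (lower-flips₂ y-z) (cong -_ˢ y₂)

          square : σ₃ z ≡ - s ˢ → Exhausts (x ∷ m ∷ y ∷ z ∷ []) (squareTypes s)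
          square z₃ = record
            { distinct = (differ σ₂ x₂ m₂ ∷ differ σ₃ x₃ y₃ ∷ differ′ σ₁ x₁ z₁ ∷ [])
                       ∷ (differ′ σ₂ m₂ y₂ ∷ differ σ₃ m₃ z₃ ∷ [])
                       ∷ (differ σ₂ y₂ z₂ ∷ [])
                       ∷ [] ∷ []
            ; inside   = Cx ∷ Cm ∷ Cy ∷ closure Cy (inj₁ y-z) ∷ []
            ; closed   = nbrs (lower-only (lower-sym m-x) #1) (upper-none (trans x₂ (sym x₃)))
                       ∷ nbrs (lower-only m-x #0) (upper-only m-y #2)
                       ∷ nbrs (lower-only y-z #3) (upper-only (upper-sym m-y) #1)
                       ∷ nbrs (lower-only (lower-sym y-z) #2) (upper-none (trans z₂ (sym z₃)))
                       ∷ []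
            ; types    = type≡ x₁ x₂ x₃ ∷ type≡ m₁ m₂ m₃ ∷ type≡ y₁ y₂ y₃ ∷ type≡ z₁ z₂ z₃ ∷ []
            }

          -- z = (s, -s, s) has an upper neighbour z′, and (m, y, z, z′) is
          -- a non-flat chain through y.
          W-at-y : σ₃ z ≡ s → ⊥
          W-at-y z₃ = noW y (Chains.square-in-W G i record
            { a-b = upper-nbr (upper-sym m-y) ; b-a′ = lower-nbr y-z ; a′-b′ = upper-nbr (upper-sym z-z′)
            ; distinct = (differ′ σ₂ m₂ y₂ ∷ m≢z ∷ differ′ σ₂ m₂ z′₂ ∷ [])
                       ∷ (differ σ₂ y₂ z₂ ∷ y≢z′ ∷ [])
                       ∷ (differ′ σ₂ z₂ z′₂ ∷ [])
                       ∷ [] ∷ []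
            })
            where
            upper-of-z : ∃ (Upper z)
            upper-of-z = upper-exists z (trans z₂ (cong -_ˢ (sym z₃)))
            z′ = proj₁ upper-of-z
            z-z′ = proj₂ upper-of-z
            z′₂ : σ₂ z′ ≡ s
            z′₂ = trans (upper-flips₂ z-z′) (trans (cong -_ˢ z₂) (neg-involutive s))
            m≢z : m ≢ z
            m≢z m≡z = differ σ₃ x₃ y₃ (lower-unique m-x (lower-sym (subst (Lower y) (sym m≡z) y-z)))
            y≢z′ : y ≢ z′
            y≢z′ y≡z′ = m≢z (upper-unique (upper-sym m-y) (upper-sym (subst (Upper z) (sym y≡z′) z-z′)))

        analyse : SingleSchur Gf
        analyse with sign-cases (σ₃ x) s
        ... | inj₂ x₃ with upper-exists x (trans x₂ (sym (trans (cong -_ˢ x₃) (neg-involutive s))))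
        ...   | z , x-z with z ≟ m
        ...     | yes refl = exhausts-single s22 (pair x₃ x-z) (pair-profile s)
        ...     | no z≢m   = ⊥-elim (W-at-m x₃ x-z z≢m)
        analyse | inj₁ x₃ with sign-cases (σ₁ y) s
        ... | inj₁ y₁ = exhausts-single (hookShape s) (hook x₃ y₁) (hook-profile s)
        ... | inj₂ y₁ with lower-exists y (trans y₁ (cong -_ˢ (sym y₂)))
        ...   | z , y-z with sign-cases (σ₃ z) s
        ...     | inj₁ z₃ = ⊥-elim (W-at-y x₃ y₁ y-z z₃)
        ...     | inj₂ z₃ = ⊥-elim (exhausts-notPositive (square x₃ y₁ y-z z₃) (square-profile s))

      -- Every component contains either an isolated vertex of type
      -- (s, s, s) or a vertex of type (s, -s, s): a vertex of type
      -- (-s, s, s) has one as lower neighbour, one of type (s, s, -s) as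
      -- upper neighbour.
      single-without-W : (∀ w → ¬ InW G i w) → SingleSchur Gf
      single-without-W noW with proj₁ comp
      ... | v , Cv with sign-cases (σ₁ v) (σ₃ v) | sign-cases (σ₂ v) (σ₃ v)
      ... | inj₁ v₁ | inj₁ v₂ = exhausts-single (isolatedShape (σ₃ v)) (isolated Cv v₁ v₂) (isolated-profile (σ₃ v))
      ... | inj₁ v₁ | inj₂ v₂ = Middle.analyse noW (σ₃ v) v v₁ v₂ refl Cv
      ... | inj₂ v₁ | inj₁ v₂ with lower-exists v (trans v₁ (cong -_ˢ (sym v₂)))
      ...   | m , v-m = Middle.analyse noW (σ₃ v) m
                (trans (lower-flips₁ v-m) (trans (cong -_ˢ v₁) (neg-involutive _)))
                (trans (lower-flips₂ v-m) (cong -_ˢ v₂))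
                (lower-keeps₃ v-m (sym v₂))
                (closure Cv (inj₁ v-m))
      single-without-W noW | v , Cv | inj₂ v₁ | inj₂ v₂ with upper-exists v v₂
      ...   | m , v-m = Middle.analyse noW (σ₁ v) m
                (upper-keeps₁ v-m (trans v₁ (sym v₂)))
                (trans (upper-flips₂ v-m) (cong -_ˢ (trans v₂ (sym v₁))))
                (trans (upper-flips₃ v-m) (sym v₁))
                (closure Cv (inj₂ v-m))

noW⇒LSF4 : ∀ {n} (G : SCGraph n n) → Ax1 G → Ax2 G → Ax3 G → LSP4 G →
  (∀ i → 1 < i → i < n → ∀ w → ¬ InW G i w) → LSF4 G
noW⇒LSF4 G ax1 ax2 ax3 lsp noW i@(suc (suc (suc j))) 2<i i<n C comp =
  Window.OnComponent.single-without-W G ax1 ax2 ax3 j i<n C comp (lsp i 2<i i<n C comp) (noW i (s≤s (s≤s z≤n)) i<n)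
noW⇒LSF4 G ax1 ax2 ax3 lsp noW (suc (suc zero)) (s≤s (s≤s ())) _ _ _
noW⇒LSF4 G ax1 ax2 ax3 lsp noW (suc zero) (s≤s ()) _ _ _

-- Proposition 5.5.

proposition5p5 : ∀ (n : ℕ) (G : SCGraph n n) →
    Ax1 G → Ax2 G → Ax3 G → Ax5 G → LSP4 G →
    (LSF4 G ⇔ (∀ i → 1 < i → i < n → ∀ w → ¬ InW G i w))
proposition5p5 n G ax1 ax2 ax3 _ lsp = mk⇔ (LSF4⇒noW G) (noW⇒LSF4 G ax1 ax2 ax3 lsp)
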